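{- Let $\alpha=(a_0({\bf x}),a_1({\bf x}),a_2({\bf x}),\ldots)$ be a Stieltjes moment sequence of polynomials in ${\bf x}=(x_1,\ldots,x_n)$ such that $\deg(a_k({\bf x}))=k$ for all $k\ge0$. Then $H_{x_0}(\alpha)=(H_{x_0}(a_0({\bf x})),H_{x_0}(a_1({\bf x})),\ldots)$ is a Stieltjes moment sequence of polynomials in the variables $x_0,x_1,\ldots,x_n$.
   Context: A polynomial is nonnegative (with respect to its variables) if all its coefficients are nonnegative. A matrix of polynomials is totally positive (with respect to its variables) if every minor of every finite order has nonnegative coefficients. A sequence $(a_k)_{k\ge0}$ of polynomials is a Stieltjes moment sequence of polynomials if its Hankel matrix $[a_{i+j}]_{i,j\ge0}$ is totally positive in this sense. The degree $\deg(a({\bf x}))$ of a nonzero polynomial is the maximum total degree $i_1+\cdots+i_n$ of its monomials $x_1^{i_1}\cdots x_n^{i_n}$ with nonzero coefficient. If $\deg(a({\bf x}))=d$, then $H_{x_0}(a({\bf x}))=x_0^{d}\,a(x_1/x_0,\ldots,x_n/x_0)$ (the homogenization with respect to a new variable $x_0$). -}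

module Defs where

open import Level using (Level; _⊔_)
open import Algebra.Bundles using (CommutativeRing)
open import Data.Nat as ℕ using (ℕ; zero; suc)
open import Data.Fin as Fin using (Fin; toℕ; punchIn)
open import Data.List using (List; []; _∷_; applyUpTo)
open import Data.Vec using (Vec; []; _∷_)
open import Data.Product using (Σ; _×_; ∃)
open import Relation.Nullary using (¬_)
open import Relation.Binary.PropositionalEquality using (_≡_)

-- A "nonnegativity" predicate on a commutative ring: a positive cone
-- (closed under + and *, contains 0 and 1, respects ≈, and pointed).
-- The real numbers with P x = (0 ≤ x) are an instance.

record IsNonnegCone {c ℓ p : Level} (R : CommutativeRing c ℓ)
                    (P : CommutativeRing.Carrier R → Set p) : Set (c ⊔ ℓ ⊔ p) where
  open CommutativeRing R using (_≈_; _+_; _*_; -_; 0#; 1#)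
  field
    resp    : ∀ {x y} → x ≈ y → P x → P y
    zero-nn : P 0#
    one-nn  : P 1#
    +-nn    : ∀ {x y} → P x → P y → P (x + y)
    *-nn    : ∀ {x y} → P x → P y → P (x * y)
    pointed : ∀ {x} → P x → P (- x) → x ≈ 0#

-- Multivariate polynomials over R in n variables, as iterated
-- univariate coefficient lists:  Pol 0 = R,  Pol (n+1) = List (Pol n),
-- the list index of  Pol (suc n)  being the exponent of the FIRST
-- variable.

module Poly {c ℓ : Level} (R : CommutativeRing c ℓ) where
  open CommutativeRing R using (_≈_; _+_; _*_; -_; 0#; 1#) renaming (Carrier to A)

  data Pol : ℕ → Set c where
    const : A → Pol zero
    poly  : ∀ {n} → List (Pol n) → Pol (suc n)

  zeroP : ∀ {n} → Pol n
  zeroP {zero}  = const 0#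
  zeroP {suc n} = poly []

  oneP : ∀ {n} → Pol n
  oneP {zero}  = const 1#
  oneP {suc n} = poly (oneP ∷ [])

  addP : ∀ {n} → Pol n → Pol n → Pol n
  addL : ∀ {n} → List (Pol n) → List (Pol n) → List (Pol n)
  addP (const x) (const y) = const (x + y)
  addP (poly p) (poly q) = poly (addL p q)
  addL [] q = q
  addL (x ∷ p) [] = x ∷ p
  addL (x ∷ p) (y ∷ q) = addP x y ∷ addL p q

  negP : ∀ {n} → Pol n → Pol n
  negL : ∀ {n} → List (Pol n) → List (Pol n)
  negP (const x) = const (- x)
  negP (poly p) = poly (negL p)
  negL [] = []
  negL (x ∷ p) = negP x ∷ negL p

  mulP : ∀ {n} → Pol n → Pol n → Pol n
  scaleL : ∀ {n} → Pol n → List (Pol n) → List (Pol n)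
  mulL : ∀ {n} → List (Pol n) → List (Pol n) → List (Pol n)
  mulP (const x) (const y) = const (x * y)
  mulP (poly p) (poly q) = poly (mulL p q)
  scaleL x [] = []
  scaleL x (y ∷ q) = mulP x y ∷ scaleL x q
  mulL [] q = []
  mulL (x ∷ p) q = addL (scaleL x q) (zeroP ∷ mulL p q)

  -- coefficient of the monomial x^e (first vector entry = exponent of the
  -- outermost variable)
  coeff : ∀ {n} → Pol n → Vec ℕ n → A
  coeffL : ∀ {n} → List (Pol n) → ℕ → Vec ℕ n → A
  coeff (const x) [] = x
  coeff (poly p) (k ∷ e) = coeffL p k e
  coeffL [] k e = 0#
  coeffL (x ∷ p) zero e = coeff x e
  coeffL (x ∷ p) (suc k) e = coeffL p k e

  totdeg : ∀ {n} → Vec ℕ n → ℕ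
  totdeg [] = 0
  totdeg (k ∷ e) = k ℕ.+ totdeg e

  DegreeIs : ∀ {n} → Pol n → ℕ → Set ℓ
  DegreeIs p d =
    (∀ e → d ℕ.< totdeg e → coeff p e ≈ 0#) ×
    ∃ λ e → totdeg e ≡ d × ¬ (coeff p e ≈ 0#)

  hpart : ∀ {n} → ℕ → Pol n → Pol n
  hpartL : ∀ {n} → ℕ → List (Pol n) → List (Pol n)
  hpart zero    (const x) = const x
  hpart (suc k) (const x) = const 0#
  hpart k (poly p) = poly (hpartL k p)
  hpartL k [] = []
  hpartL zero    (x ∷ p) = hpart zero x ∷ []
  hpartL (suc k) (x ∷ p) = hpart (suc k) x ∷ hpartL k p

  -- Homogenization with respect to a new (outermost) variable x₀, for a
  -- polynomial p of degree d:  H(p) = x₀^d p(x/x₀) = Σ_j x₀^j · hpart (d ∸ j) p.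
  homog : ∀ {n} → ℕ → Pol n → Pol (suc n)
  homog d p = poly (applyUpTo (λ j → hpart (d ℕ.∸ j) p) (suc d))

  sumFin : ∀ {n r} → (Fin r → Pol n) → Pol n
  sumFin {r = zero}  f = zeroP
  sumFin {r = suc r} f = addP (f Fin.zero) (sumFin (λ i → f (Fin.suc i)))

  signP : ∀ {n} → ℕ → Pol n → Pol n
  signP zero          p = p
  signP (suc zero)    p = negP p
  signP (suc (suc k)) p = signP k p

  det : ∀ {n} (r : ℕ) → (Fin r → Fin r → Pol n) → Pol n
  det zero    M = oneP
  det (suc r) M = sumFin (λ j →
    signP (toℕ j) (mulP (M Fin.zero j) (det r (λ i k → M (Fin.suc i) (punchIn j k)))))

  StrictlyIncreasing : ∀ {r} → (Fin r → ℕ) → Set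
  StrictlyIncreasing f = ∀ i j → i Fin.< j → f i ℕ.< f j

  Matrix : ℕ → Set c
  Matrix n = ℕ → ℕ → Pol n

  minor : ∀ {n} → Matrix n → (r : ℕ) → (Fin r → ℕ) → (Fin r → ℕ) → Pol n
  minor M r rows cols = det r (λ i j → M (rows i) (cols j))

  hankel : ∀ {n} → (ℕ → Pol n) → Matrix n
  hankel a i j = a (i ℕ.+ j)

  module Positivity {p : Level} (P : A → Set p) where

    Nonneg : ∀ {n} → Pol n → Set p
    Nonneg q = ∀ e → P (coeff q e)

    TotallyPositive : ∀ {n} → Matrix n → Set p
    TotallyPositive M = ∀ r (rows cols : Fin r → ℕ) →
      StrictlyIncreasing rows → StrictlyIncreasing cols →
      Nonneg (minor M r rows cols)

    StieltjesMoment : ∀ {n} → (ℕ → Pol n) → Set p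
    StieltjesMoment a = TotallyPositive (hankel a)

-- The homogenization x₀ᴺ p(x/x₀) of a polynomial p of degree ≤ N is additive and
-- multiplicative, the degrees adding up under products.  In the Laplace expansion of
-- the minor of [H(a_{i+j})] with rows r and columns c every term is homogenized in
-- degree Σr + Σc, so that minor is the homogenization of the corresponding minor of
-- [a_{i+j}].  A homogenization has the coefficients of the original polynomial plus
-- zeros, hence nonnegative ones.

module Submission where

open import Defs
open import Level using (Level)
open import Algebra.Bundles using (CommutativeRing)
open import Data.Nat using (ℕ)

open import Algebra.Bundles using (CommutativeMonoid)
import Algebra.Properties.CommutativeMonoid.Sum as CommutativeMonoidSum
import Algebra.Properties.CommutativeSemigroup as CommutativeSemigroupProperties
import Algebra.Properties.Ring as RingProperties
open import Data.Empty using (⊥-elim)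
open import Data.Fin as Fin using (Fin; toℕ; fromℕ<; punchIn)
open import Data.Fin.Properties using (toℕ≤pred[n]; toℕ-fromℕ<; toℕ-injective; punchInᵢ≢i)
open import Data.List using (List; []; _∷_; applyUpTo)
open import Data.Nat as ℕ using (zero; suc; _≤_; _<_; _≤?_; _≟_; s≤s)
import Data.Nat.Properties as ℕₚ
open import Data.Product using (_×_; _,_; proj₁; proj₂)
open import Data.Vec using (Vec; []; _∷_)
open import Data.Vec.Functional using (removeAt)
open import Relation.Binary.PropositionalEquality as ≡ using (_≡_; _≢_; refl; cong; subst)
open import Relation.Nullary using (yes; no)

module _ where
  open import Data.Nat using (_+_; _∸_)
  open ℕₚ
  open CommutativeSemigroupProperties +-commutativeSemigroup
    using (interchange; x∙yz≈xz∙y; xy∙z≈xz∙y)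
  open ≡.≡-Reasoning

  +-∸-interchange : ∀ {i k a b t} → i ≤ k → a + b ≡ t → (i + a) + ((k ∸ i) + b) ≡ k + t
  +-∸-interchange {i} {k} {a} {b} i≤k refl = begin
    (i + a) + ((k ∸ i) + b) ≡⟨ interchange i a (k ∸ i) b ⟩
    (i + (k ∸ i)) + (a + b) ≡⟨ cong (_+ (a + b)) (m+[n∸m]≡n i≤k) ⟩
    k + (a + b)             ∎

  complementary-exponent : ∀ {i a b m N M} → i + a ≡ N → b ≤ M →
                           m + (a + b) ≡ N + M → i ≤ m × (m ∸ i) + b ≡ M
  complementary-exponent {i} {a} {b} {m} {M = M} refl b≤M eq =
    i≤m , +-cancelˡ-≡ i _ _ (begin
      i + ((m ∸ i) + b) ≡⟨ +-assoc i (m ∸ i) b ⟨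
      (i + (m ∸ i)) + b ≡⟨ cong (_+ b) (m+[n∸m]≡n i≤m) ⟩
      m + b             ≡⟨ m+b≡i+M ⟩
      i + M             ∎)
    where
    m+b≡i+M : m + b ≡ i + M
    m+b≡i+M = +-cancelʳ-≡ a _ _
      (≡.trans (≡.sym (x∙yz≈xz∙y m a b)) (≡.trans eq (xy∙z≈xz∙y i a M)))
    i≤m : i ≤ m
    i≤m = +-cancelʳ-≤ M i m (≤-trans (≤-reflexive (≡.sym m+b≡i+M)) (+-monoʳ-≤ m b≤M))

  m+n<o+p∧o≤m⇒n<p : ∀ {m n o p} → m + n < o + p → o ≤ m → n < p
  m+n<o+p∧o≤m⇒n<p {n = n} {p = p} lt o≤m with n ℕ.<? p
  ... | yes n<p = n<p
  ... | no n≮p = ⊥-elim (<⇒≱ lt (+-mono-≤ o≤m (≮⇒≥ n≮p)))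

module SumProperties {a ℓ} (M : CommutativeMonoid a ℓ) where
  open CommutativeMonoid M renaming (Carrier to A; _∙_ to _+_; ε to 0#; identityʳ to +-identityʳ)
  open CommutativeMonoidSum M using (sum; sum-cong-≋; sum-replicate-zero; sum-remove)
  open import Relation.Binary.Reasoning.Setoid setoid

  sum-zero : ∀ {k} (f : Fin k → A) → (∀ i → f i ≈ 0#) → sum f ≈ 0#
  sum-zero {k} f f≈0 = trans (sum-cong-≋ f≈0) (sum-replicate-zero k)

  sum-single : ∀ {k} (f : Fin (suc k) → A) i → (∀ j → j ≢ i → f j ≈ 0#) → sum f ≈ f i
  sum-single f i others = begin
    sum f                    ≈⟨ sum-remove {i = i} f ⟩
    f i + sum (removeAt f i) ≈⟨ ∙-congˡ (sum-zero _ λ j → others _ (punchInᵢ≢i i j)) ⟩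
    f i + 0#                 ≈⟨ +-identityʳ _ ⟩
    f i                      ∎

module Coefficients {c ℓ : Level} (R : CommutativeRing c ℓ) where
  open Poly R
  open CommutativeRing R hiding (zero) renaming (Carrier to A; refl to ≈-refl)
  open RingProperties ring using (-0#≈0#)
  open CommutativeMonoidSum +-commutativeMonoid
    using (sum; sum⁺-syntax; sum-cong-≋; ∑-comm)
  open SumProperties +-commutativeMonoid using (sum-zero)

  ∣_∣ : ∀ {n} → Vec ℕ n → ℕ
  ∣_∣ = totdeg

  splitSum : ∀ n → (Vec ℕ n → Vec ℕ n → A) → Vec ℕ n → A
  splitSum zero    h []      = h [] []
  splitSum (suc n) h (k ∷ e) =
    ∑[ i ≤ k ] splitSum n (λ e₁ e₂ → h (toℕ i ∷ e₁) ((k ℕ.∸ toℕ i) ∷ e₂)) e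

  splitSum-cong : ∀ n {h h′} e → (∀ e₁ e₂ → ∣ e₁ ∣ ℕ.+ ∣ e₂ ∣ ≡ ∣ e ∣ → h e₁ e₂ ≈ h′ e₁ e₂) →
                  splitSum n h e ≈ splitSum n h′ e
  splitSum-cong zero    []      h≈h′ = h≈h′ [] [] refl
  splitSum-cong (suc n) (k ∷ e) h≈h′ =
    sum-cong-≋ {suc k} {x = λ i → splitSum n _ e} {y = λ i → splitSum n _ e} λ i →
    splitSum-cong n e λ e₁ e₂ eq →
      h≈h′ (toℕ i ∷ e₁) ((k ℕ.∸ toℕ i) ∷ e₂) (+-∸-interchange (toℕ≤pred[n] i) eq)

  splitSum-zero : ∀ n {h} e → (∀ e₁ e₂ → ∣ e₁ ∣ ℕ.+ ∣ e₂ ∣ ≡ ∣ e ∣ → h e₁ e₂ ≈ 0#) →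
                  splitSum n h e ≈ 0#
  splitSum-zero zero    []      h≈0 = h≈0 [] [] refl
  splitSum-zero (suc n) (k ∷ e) h≈0 = sum-zero {suc k} (λ i → splitSum n _ e) λ i →
    splitSum-zero n e λ e₁ e₂ eq →
      h≈0 (toℕ i ∷ e₁) ((k ℕ.∸ toℕ i) ∷ e₂) (+-∸-interchange (toℕ≤pred[n] i) eq)

  sum-splitSum-comm : ∀ n {r} (h : Fin r → Vec ℕ n → Vec ℕ n → A) e →
                      sum (λ i → splitSum n (h i) e) ≈
                      splitSum n (λ e₁ e₂ → sum (λ i → h i e₁ e₂)) e
  sum-splitSum-comm zero    h []      = ≈-refl
  sum-splitSum-comm (suc n) h (k ∷ e) = trans (∑-comm (λ i j → splitSum n (hₖ i j) e))
    (sum-cong-≋ {suc k} {x = λ j → sum λ i → splitSum n (hₖ i j) e} {y = λ j → splitSum n _ e}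
      λ j → sum-splitSum-comm n (λ i → hₖ i j) e)
    where
    hₖ = λ i j e₁ e₂ → h i (toℕ j ∷ e₁) ((k ℕ.∸ toℕ j) ∷ e₂)

  coeff-zeroP : ∀ {n} (e : Vec ℕ n) → coeff zeroP e ≈ 0#
  coeff-zeroP []      = ≈-refl
  coeff-zeroP (k ∷ e) = ≈-refl

  coeff-oneP : ∀ {n} (e : Vec ℕ n) → 0 < ∣ e ∣ → coeff oneP e ≈ 0#
  coeff-oneP (zero  ∷ e) 0<∣e∣ = coeff-oneP e 0<∣e∣
  coeff-oneP (suc k ∷ e) _     = ≈-refl

  coeff-addP  : ∀ {n} (p q : Pol n) e → coeff (addP p q) e ≈ coeff p e + coeff q e
  coeffL-addL : ∀ {n} (p q : List (Pol n)) k e →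
                coeffL (addL p q) k e ≈ coeffL p k e + coeffL q k e
  coeff-addP (const x) (const y) []      = ≈-refl
  coeff-addP (poly p)  (poly q)  (k ∷ e) = coeffL-addL p q k e
  coeffL-addL []      q       k       e = sym (+-identityˡ _)
  coeffL-addL (x ∷ p) []      k       e = sym (+-identityʳ _)
  coeffL-addL (x ∷ p) (y ∷ q) zero    e = coeff-addP x y e
  coeffL-addL (x ∷ p) (y ∷ q) (suc k) e = coeffL-addL p q k e

  coeff-negP  : ∀ {n} (p : Pol n) e → coeff (negP p) e ≈ - coeff p e
  coeffL-negL : ∀ {n} (p : List (Pol n)) k e → coeffL (negL p) k e ≈ - coeffL p k e
  coeff-negP (const x) []      = ≈-refl
  coeff-negP (poly p)  (k ∷ e) = coeffL-negL p k e
  coeffL-negL []      k       e = sym -0#≈0#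
  coeffL-negL (x ∷ p) zero    e = coeff-negP x e
  coeffL-negL (x ∷ p) (suc k) e = coeffL-negL p k e

  coeff-mulP    : ∀ {n} (p q : Pol n) e →
                  coeff (mulP p q) e ≈ splitSum n (λ e₁ e₂ → coeff p e₁ * coeff q e₂) e
  coeffL-scaleL : ∀ {n} (x : Pol n) (q : List (Pol n)) k e →
                  coeffL (scaleL x q) k e ≈ splitSum n (λ e₁ e₂ → coeff x e₁ * coeffL q k e₂) e
  coeffL-mulL   : ∀ {n} (p q : List (Pol n)) k e →
                  coeffL (mulL p q) k e ≈
                  splitSum (suc n) (λ e₁ e₂ → coeff (poly p) e₁ * coeff (poly q) e₂) (k ∷ e)
  coeff-mulP (const x) (const y) []      = ≈-refl
  coeff-mulP (poly p)  (poly q)  (k ∷ e) = coeffL-mulL p q k e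
  coeffL-scaleL {n} x []      k       e = sym (splitSum-zero n e λ _ _ _ → zeroʳ _)
  coeffL-scaleL     x (y ∷ q) zero    e = coeff-mulP x y e
  coeffL-scaleL     x (y ∷ q) (suc k) e = coeffL-scaleL x q k e
  coeffL-mulL {n} [] q k e =
    sym (sum-zero {suc k} (λ i → splitSum n (λ _ e₂ → 0# * coeffL q (k ℕ.∸ toℕ i) e₂) e)
      λ _ → splitSum-zero n e λ _ _ _ → zeroˡ _)
  coeffL-mulL (x ∷ p) q zero e = trans (coeffL-addL (scaleL x q) _ 0 e)
    (+-cong (coeffL-scaleL x q 0 e) (coeff-zeroP e))
  coeffL-mulL (x ∷ p) q (suc k) e = trans (coeffL-addL (scaleL x q) _ (suc k) e)
    (+-cong (coeffL-scaleL x q (suc k) e) (coeffL-mulL p q k e))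

  coeff-mulP-∷ : ∀ {n} (F G : Pol (suc n)) m e →
                 coeff (mulP F G) (m ∷ e) ≈
                 splitSum n (λ e₁ e₂ →
                   ∑[ i ≤ m ] (coeff F (toℕ i ∷ e₁) * coeff G ((m ℕ.∸ toℕ i) ∷ e₂))) e
  coeff-mulP-∷ {n} F G m e = trans (coeff-mulP F G (m ∷ e)) (sum-splitSum-comm n term e)
    where
    term : Fin (suc m) → Vec ℕ n → Vec ℕ n → A
    term i e₁ e₂ = coeff F (toℕ i ∷ e₁) * coeff G ((m ℕ.∸ toℕ i) ∷ e₂)

  coeff-hpart   : ∀ {n} d (p : Pol n) e →
                  (∣ e ∣ ≡ d → coeff (hpart d p) e ≈ coeff p e) ×
                  (∣ e ∣ ≢ d → coeff (hpart d p) e ≈ 0#)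
  coeffL-hpartL : ∀ {n} d (p : List (Pol n)) k e →
                  (k ℕ.+ ∣ e ∣ ≡ d → coeffL (hpartL d p) k e ≈ coeffL p k e) ×
                  (k ℕ.+ ∣ e ∣ ≢ d → coeffL (hpartL d p) k e ≈ 0#)
  coeff-hpart zero    (const x) []      = (λ _ → ≈-refl) , (λ 0≢0 → ⊥-elim (0≢0 refl))
  coeff-hpart (suc d) (const x) []      = (λ ()) , (λ _ → ≈-refl)
  coeff-hpart zero    (poly p)  (k ∷ e) = coeffL-hpartL zero p k e
  coeff-hpart (suc d) (poly p)  (k ∷ e) = coeffL-hpartL (suc d) p k e
  coeffL-hpartL d       []      k       e = (λ _ → ≈-refl) , (λ _ → ≈-refl)
  coeffL-hpartL zero    (x ∷ p) zero    e = coeff-hpart zero x e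
  coeffL-hpartL zero    (x ∷ p) (suc k) e = (λ ()) , (λ _ → ≈-refl)
  coeffL-hpartL (suc d) (x ∷ p) zero    e = coeff-hpart (suc d) x e
  coeffL-hpartL (suc d) (x ∷ p) (suc k) e with coeffL-hpartL d p k e
  ... | on , off = (λ eq → on (ℕₚ.suc-injective eq)) , (λ ne → off (λ eq → ne (cong suc eq)))

  coeffL-applyUpTo-< : ∀ {n} L (f : ℕ → Pol n) m e → m < L →
                       coeffL (applyUpTo f L) m e ≡ coeff (f m) e
  coeffL-applyUpTo-< (suc L) f zero    e _         = refl
  coeffL-applyUpTo-< (suc L) f (suc m) e (s≤s m<L) = coeffL-applyUpTo-< L (λ i → f (suc i)) m e m<L

  coeffL-applyUpTo-≥ : ∀ {n} L (f : ℕ → Pol n) m e → L ≤ m → coeffL (applyUpTo f L) m e ≡ 0#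
  coeffL-applyUpTo-≥ zero    f m       e _         = refl
  coeffL-applyUpTo-≥ (suc L) f (suc m) e (s≤s L≤m) = coeffL-applyUpTo-≥ L (λ i → f (suc i)) m e L≤m

  DegreeAtMost : ∀ {n} → ℕ → Pol n → Set ℓ
  DegreeAtMost d p = ∀ e → d < ∣ e ∣ → coeff p e ≈ 0#

  degreeAtMost-mulP : ∀ {n N M} {p q : Pol n} → DegreeAtMost N p → DegreeAtMost M q →
                      DegreeAtMost (N ℕ.+ M) (mulP p q)
  degreeAtMost-mulP {n} {N} {p = p} {q} p≤N q≤M e N+M<∣e∣ =
    trans (coeff-mulP p q e) (splitSum-zero n e vanishes)
    where
    vanishes : ∀ e₁ e₂ → ∣ e₁ ∣ ℕ.+ ∣ e₂ ∣ ≡ ∣ e ∣ → coeff p e₁ * coeff q e₂ ≈ 0#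
    vanishes e₁ e₂ eq with ∣ e₁ ∣ ≤? N
    ... | no  e₁≰N = trans (*-congʳ (p≤N e₁ (ℕₚ.≰⇒> e₁≰N))) (zeroˡ _)
    ... | yes e₁≤N = trans (*-congˡ (q≤M e₂ M<e₂)) (zeroʳ _)
      where M<e₂ = m+n<o+p∧o≤m⇒n<p (subst (N ℕ.+ _ <_) (≡.sym eq) N+M<∣e∣) e₁≤N

module Homogenization {c ℓ : Level} (R : CommutativeRing c ℓ) where
  open Poly R
  open Coefficients R
  open CommutativeRing R hiding (zero) renaming (Carrier to A; refl to ≈-refl)
  open RingProperties ring using (-0#≈0#)
  open CommutativeMonoidSum ℕₚ.+-0-commutativeMonoid using ()
    renaming (sum to ∑ℕ; sum-remove to ∑ℕ-remove)
  open CommutativeMonoidSum +-commutativeMonoid using (sum⁺-syntax)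
  open SumProperties +-commutativeMonoid using (sum-zero; sum-single)

  -- F = x₀ᴺ p(x₁/x₀, …, xₙ/x₀), which requires deg p ≤ N.
  record IsHomogenization {n} (N : ℕ) (F : Pol (suc n)) (p : Pol n) : Set ℓ where
    field
      coeff-on  : ∀ m e → m ℕ.+ ∣ e ∣ ≡ N → coeff F (m ∷ e) ≈ coeff p e
      coeff-off : ∀ m e → m ℕ.+ ∣ e ∣ ≢ N → coeff F (m ∷ e) ≈ 0#
      degree≤   : DegreeAtMost N p
  open IsHomogenization

  isHomogenization-cong : ∀ {n N N′} {F : Pol (suc n)} {p} → N ≡ N′ →
                          IsHomogenization N F p → IsHomogenization N′ F p
  isHomogenization-cong refl F~p = F~p

  isHomogenization-zeroP : ∀ {n} N → IsHomogenization {n} N zeroP zeroP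
  isHomogenization-zeroP N = record
    { coeff-on  = λ m e _ → trans (coeff-zeroP (m ∷ e)) (sym (coeff-zeroP e))
    ; coeff-off = λ m e _ → coeff-zeroP (m ∷ e)
    ; degree≤   = λ e _ → coeff-zeroP e
    }

  isHomogenization-oneP : ∀ {n} → IsHomogenization {n} 0 oneP oneP
  isHomogenization-oneP = record
    { coeff-on  = λ { zero e _ → ≈-refl ; (suc m) e () }
    ; coeff-off = λ { zero e ∣e∣≢0 → coeff-oneP e (ℕₚ.n≢0⇒n>0 ∣e∣≢0) ; (suc m) e _ → ≈-refl }
    ; degree≤   = coeff-oneP
    }

  isHomogenization-addP : ∀ {n N F G} {p q : Pol n} →
                          IsHomogenization N F p → IsHomogenization N G q →
                          IsHomogenization N (addP F G) (addP p q)
  isHomogenization-addP {F = F} {G} {p} {q} F~p G~q = record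
    { coeff-on  = λ m e eq → trans (coeff-addP F G (m ∷ e))
        (trans (+-cong (coeff-on F~p m e eq) (coeff-on G~q m e eq)) (sym (coeff-addP p q e)))
    ; coeff-off = λ m e ne → trans (coeff-addP F G (m ∷ e))
        (trans (+-cong (coeff-off F~p m e ne) (coeff-off G~q m e ne)) (+-identityˡ 0#))
    ; degree≤   = λ e lt → trans (coeff-addP p q e)
        (trans (+-cong (degree≤ F~p e lt) (degree≤ G~q e lt)) (+-identityˡ 0#))
    }

  isHomogenization-negP : ∀ {n N F} {p : Pol n} →
                          IsHomogenization N F p → IsHomogenization N (negP F) (negP p)
  isHomogenization-negP {F = F} {p} F~p = record
    { coeff-on  = λ m e eq → trans (coeff-negP F (m ∷ e))
        (trans (-‿cong (coeff-on F~p m e eq)) (sym (coeff-negP p e)))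
    ; coeff-off = λ m e ne → trans (coeff-negP F (m ∷ e))
        (trans (-‿cong (coeff-off F~p m e ne)) -0#≈0#)
    ; degree≤   = λ e lt → trans (coeff-negP p e) (trans (-‿cong (degree≤ F~p e lt)) -0#≈0#)
    }

  isHomogenization-signP : ∀ {n N F} {p : Pol n} k →
                           IsHomogenization N F p → IsHomogenization N (signP k F) (signP k p)
  isHomogenization-signP zero          F~p = F~p
  isHomogenization-signP (suc zero)    F~p = isHomogenization-negP F~p
  isHomogenization-signP (suc (suc k)) F~p = isHomogenization-signP k F~p

  isHomogenization-sumFin : ∀ {n N r} {F : Fin r → Pol (suc n)} {p : Fin r → Pol n} →
                            (∀ j → IsHomogenization N (F j) (p j)) →
                            IsHomogenization N (sumFin F) (sumFin p)
  isHomogenization-sumFin {N = N} {zero}  F~p = isHomogenization-zeroP N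
  isHomogenization-sumFin {N = N} {suc r} F~p =
    isHomogenization-addP (F~p Fin.zero) (isHomogenization-sumFin (λ j → F~p (Fin.suc j)))

  module _ {n N M} {F G : Pol (suc n)} {p q : Pol n}
           (F~p : IsHomogenization N F p) (G~q : IsHomogenization M G q) where

    productTerm : ∀ m → Vec ℕ n → Vec ℕ n → Fin (suc m) → A
    productTerm m e₁ e₂ i = coeff F (toℕ i ∷ e₁) * coeff G ((m ℕ.∸ toℕ i) ∷ e₂)

    -- The coefficient of x₀ᵐ in F_{e₁} G_{e₂}, where F_e ∈ R[x₀] is the coefficient of xᵉ in F.
    productCoeff : ℕ → Vec ℕ n → Vec ℕ n → A
    productCoeff m e₁ e₂ = ∑[ i ≤ m ] productTerm m e₁ e₂ i

    productTerm-zeroˡ : ∀ m e₁ e₂ {i : Fin (suc m)} → toℕ i ℕ.+ ∣ e₁ ∣ ≢ N →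
                        productTerm m e₁ e₂ i ≈ 0#
    productTerm-zeroˡ m e₁ e₂ ne = trans (*-congʳ (coeff-off F~p _ e₁ ne)) (zeroˡ _)

    productTerm-zeroʳ : ∀ m e₁ e₂ {i : Fin (suc m)} → (m ℕ.∸ toℕ i) ℕ.+ ∣ e₂ ∣ ≢ M →
                        productTerm m e₁ e₂ i ≈ 0#
    productTerm-zeroʳ m e₁ e₂ ne = trans (*-congˡ (coeff-off G~q _ e₂ ne)) (zeroʳ _)

    productCoeff-off : ∀ m e₁ e₂ → m ℕ.+ (∣ e₁ ∣ ℕ.+ ∣ e₂ ∣) ≢ N ℕ.+ M → productCoeff m e₁ e₂ ≈ 0#
    productCoeff-off m e₁ e₂ ne = sum-zero (productTerm m e₁ e₂) vanishes
      where
      vanishes : ∀ i → productTerm m e₁ e₂ i ≈ 0#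
      vanishes i with toℕ i ℕ.+ ∣ e₁ ∣ ≟ N | (m ℕ.∸ toℕ i) ℕ.+ ∣ e₂ ∣ ≟ M
      ... | no  ≢N | _      = productTerm-zeroˡ m e₁ e₂ ≢N
      ... | yes _  | no ≢M  = productTerm-zeroʳ m e₁ e₂ ≢M
      ... | yes ≡N | yes ≡M = ⊥-elim (ne (≡.trans (≡.sym (+-∸-interchange (toℕ≤pred[n] i) refl))
                                                  (≡.cong₂ ℕ._+_ ≡N ≡M)))

    productCoeff-on : ∀ m e₁ e₂ → m ℕ.+ (∣ e₁ ∣ ℕ.+ ∣ e₂ ∣) ≡ N ℕ.+ M →
                      productCoeff m e₁ e₂ ≈ coeff p e₁ * coeff q e₂
    productCoeff-on m e₁ e₂ eq with ∣ e₁ ∣ ≤? N | ∣ e₂ ∣ ≤? M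
    ... | no e₁≰N | _ = trans
      (sum-zero (productTerm m e₁ e₂) λ i → productTerm-zeroˡ m e₁ e₂ λ i+e₁≡N →
        e₁≰N (subst (∣ e₁ ∣ ≤_) i+e₁≡N (ℕₚ.m≤n+m _ _)))
      (sym (trans (*-congʳ (degree≤ F~p e₁ (ℕₚ.≰⇒> e₁≰N))) (zeroˡ _)))
    ... | yes _ | no e₂≰M = trans
      (sum-zero (productTerm m e₁ e₂) λ i → productTerm-zeroʳ m e₁ e₂ λ rest+e₂≡M →
        e₂≰M (subst (∣ e₂ ∣ ≤_) rest+e₂≡M (ℕₚ.m≤n+m _ _)))
      (sym (trans (*-congˡ (degree≤ G~q e₂ (ℕₚ.≰⇒> e₂≰M))) (zeroʳ _)))
    ... | yes e₁≤N | yes e₂≤M = trans (sum-single (productTerm m e₁ e₂) i₀ others)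
      (*-cong (coeff-on F~p _ e₁ i₀+e₁≡N) (coeff-on G~q _ e₂ rest+e₂≡M))
      where
      split = complementary-exponent (ℕₚ.m∸n+n≡m e₁≤N) e₂≤M eq
      i₀ : Fin (suc m)
      i₀ = fromℕ< (s≤s (proj₁ split))
      toℕ-i₀ : toℕ i₀ ≡ N ℕ.∸ ∣ e₁ ∣
      toℕ-i₀ = toℕ-fromℕ< (s≤s (proj₁ split))
      i₀+e₁≡N : toℕ i₀ ℕ.+ ∣ e₁ ∣ ≡ N
      i₀+e₁≡N = ≡.trans (cong (ℕ._+ ∣ e₁ ∣) toℕ-i₀) (ℕₚ.m∸n+n≡m e₁≤N)
      rest+e₂≡M : (m ℕ.∸ toℕ i₀) ℕ.+ ∣ e₂ ∣ ≡ M
      rest+e₂≡M = ≡.trans (cong (λ i → (m ℕ.∸ i) ℕ.+ ∣ e₂ ∣) toℕ-i₀) (proj₂ split)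
      others : ∀ j → j ≢ i₀ → productTerm m e₁ e₂ j ≈ 0#
      others j j≢i₀ = productTerm-zeroˡ m e₁ e₂ λ j+e₁≡N →
        j≢i₀ (toℕ-injective (ℕₚ.+-cancelʳ-≡ ∣ e₁ ∣ _ _ (≡.trans j+e₁≡N (≡.sym i₀+e₁≡N))))

    isHomogenization-mulP : IsHomogenization (N ℕ.+ M) (mulP F G) (mulP p q)
    isHomogenization-mulP = record
      { coeff-on  = λ m e eq → trans (coeff-mulP-∷ F G m e)
          (trans (splitSum-cong n e λ e₁ e₂ e₁+e₂≡e →
                    productCoeff-on m e₁ e₂ (≡.trans (cong (m ℕ.+_) e₁+e₂≡e) eq))
                 (sym (coeff-mulP p q e)))
      ; coeff-off = λ m e ne → trans (coeff-mulP-∷ F G m e)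
          (splitSum-zero n {productCoeff m} e λ e₁ e₂ e₁+e₂≡e →
            productCoeff-off m e₁ e₂ λ eq → ne (≡.trans (cong (m ℕ.+_) (≡.sym e₁+e₂≡e)) eq))
      ; degree≤   = degreeAtMost-mulP {p = p} {q} (degree≤ F~p) (degree≤ G~q)
      }

  isHomogenization-det : ∀ {n} r {F : Fin r → Fin r → Pol (suc n)} {B : Fin r → Fin r → Pol n}
                         (u v : Fin r → ℕ) →
                         (∀ i j → IsHomogenization (u i ℕ.+ v j) (F i j) (B i j)) →
                         IsHomogenization (∑ℕ u ℕ.+ ∑ℕ v) (det r F) (det r B)
  isHomogenization-det zero    u v _   = isHomogenization-oneP
  isHomogenization-det (suc r) u v F~B = isHomogenization-sumFin λ j →
    isHomogenization-signP (toℕ j) (isHomogenization-cong (degree-rearrange j)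
      (isHomogenization-mulP (F~B Fin.zero j)
        (isHomogenization-det r (λ i → u (Fin.suc i)) (removeAt v j)
          (λ i k → F~B (Fin.suc i) (punchIn j k)))))
    where
    open CommutativeSemigroupProperties ℕₚ.+-commutativeSemigroup using (interchange)
    u′ = λ i → u (Fin.suc i)
    degree-rearrange : ∀ j → (u Fin.zero ℕ.+ v j) ℕ.+ (∑ℕ u′ ℕ.+ ∑ℕ (removeAt v j)) ≡ ∑ℕ u ℕ.+ ∑ℕ v
    degree-rearrange j = ≡.trans (interchange (u Fin.zero) (v j) (∑ℕ u′) (∑ℕ (removeAt v j)))
                                 (cong (∑ℕ u ℕ.+_) (≡.sym (∑ℕ-remove {i = j} v)))

  isHomogenization-homog : ∀ {n} k (p : Pol n) → DegreeAtMost k p → IsHomogenization k (homog k p) p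
  isHomogenization-homog k p p≤k = record { coeff-on = on ; coeff-off = off ; degree≤ = p≤k }
    where
    part : ℕ → Pol _
    part j = hpart (k ℕ.∸ j) p
    on : ∀ m e → m ℕ.+ ∣ e ∣ ≡ k → coeff (homog k p) (m ∷ e) ≈ coeff p e
    on m e refl = subst (_≈ coeff p e)
      (≡.sym (coeffL-applyUpTo-< (suc k) part m e (s≤s (ℕₚ.m≤m+n m ∣ e ∣))))
      (proj₁ (coeff-hpart (k ℕ.∸ m) p e) (≡.sym (ℕₚ.m+n∸m≡n m ∣ e ∣)))
    off : ∀ m e → m ℕ.+ ∣ e ∣ ≢ k → coeff (homog k p) (m ∷ e) ≈ 0#
    off m e ne with m ≤? k
    ... | yes m≤k = subst (_≈ 0#)
      (≡.sym (coeffL-applyUpTo-< (suc k) part m e (s≤s m≤k)))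
      (proj₂ (coeff-hpart (k ℕ.∸ m) p e) λ eq → ne (≡.trans (cong (m ℕ.+_) eq) (ℕₚ.m+[n∸m]≡n m≤k)))
    ... | no m≰k = subst (_≈ 0#) (≡.sym (coeffL-applyUpTo-≥ (suc k) part m e (ℕₚ.≰⇒> m≰k))) ≈-refl

  module _ {ℓ′} {P : A → Set ℓ′} (cone : IsNonnegCone R P) where
    open IsNonnegCone cone using (resp; zero-nn)
    open Positivity P

    nonneg-homogenization : ∀ {n N} {F : Pol (suc n)} {p} →
                            IsHomogenization N F p → Nonneg p → Nonneg F
    nonneg-homogenization {N = N} F~p p≥0 (m ∷ e) with m ℕ.+ ∣ e ∣ ≟ N
    ... | yes eq = resp (sym (coeff-on F~p m e eq)) (p≥0 e)
    ... | no  ne = resp (sym (coeff-off F~p m e ne)) zero-nn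

    totallyPositive-homogenization : ∀ {n} {M′ : Matrix (suc n)} {M : Matrix n} →
                                     (∀ i j → IsHomogenization (i ℕ.+ j) (M′ i j) (M i j)) →
                                     TotallyPositive M → TotallyPositive M′
    totallyPositive-homogenization M′~M M-tp r rows cols rows↑ cols↑ =
      nonneg-homogenization (isHomogenization-det r rows cols λ i j → M′~M (rows i) (cols j))
                            (M-tp r rows cols rows↑ cols↑)

theorem2p5 : ∀ {c ℓ p : Level} (R : CommutativeRing c ℓ)
               (P : CommutativeRing.Carrier R → Set p) → IsNonnegCone R P →
               (n : ℕ) (a : ℕ → Poly.Pol R n) →
               Poly.Positivity.StieltjesMoment R P a →
               (∀ k → Poly.DegreeIs R (a k) k) →
               Poly.Positivity.StieltjesMoment R P (λ k → Poly.homog R k (a k))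
theorem2p5 R P cone n a a-moment deg[a] =
  totallyPositive-homogenization cone
    (λ i j → isHomogenization-homog (i ℕ.+ j) (a (i ℕ.+ j)) (proj₁ (deg[a] (i ℕ.+ j))))
    a-moment
  where open Homogenization R
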